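{- Let $r,c\ge 1$ and let $B\subseteq [r]\times[r+1,r+c]$ be a board with $r$ rows and $c$ columns in which every row and every column contains at least one cell. Let $$\mathcal{B}=\{R(\sigma)\cup C(\sigma):\ \sigma \text{ a non-nesting rook placement on } B\}.$$ If $([r+c],\mathcal{B})$ is a matroid with set of bases $\mathcal{B}$, then $B$ is equal to some skew shape $\lambda/\mu$ (with the same row and column labelling).
   Context: Boards: a board with $r$ rows and $c$ columns is a subset of $[r]\times[r+1,r+c]$; a cell $(i,j)$ lies in row $i$ and column $j$; rows are labelled $1,\dots,r$ from top to bottom and columns $r+1,\dots,r+c$ from left to right. For integer partitions $\lambda\supseteq\mu$ of length at most $r$ (with $\mu$ padded by zeros), the skew shape $\lambda/\mu$ is the board $\{(i,r+j): 1\le i\le r,\ \mu_i<j\le\lambda_i\}$ (every row and column assumed nonempty). A non-attacking rook placement on a board $B$ is a subset of $B$ no two cells of which share a row or a column; it is non-nesting if moreover there are no two of its cells $(i,j),(k,\ell)$ with $i<k$ and $j<\ell$. For a rook placement $\sigma$, $R(\sigma)$ is the set of row indices occupied by $\sigma$ and $C(\sigma)$ is the set of column indices not occupied by $\sigma$; both are regarded as subsets of $[r+c]$. -}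

module Defs where

open import Data.Nat using (ℕ; zero; suc; _+_; _≤_)
open import Data.Fin using (Fin; zero; suc; splitAt; toℕ) renaming (_<_ to _<ᶠ_; _≤_ to _≤ᶠ_)
open import Data.Fin.Subset using (Subset; _∈_; _∉_; _-_; _∪_; ⁅_⁆)
open import Data.Bool using (Bool; true; false; _∨_; not)
open import Data.Vec using (tabulate)
open import Data.Sum using (inj₁; inj₂)
open import Data.Product using (Σ; _×_; ∃; ∃-syntax)
open import Relation.Binary.PropositionalEquality using (_≡_)
open import Relation.Nullary using (¬_)

-- A board with r rows and c columns.  Row i : Fin r stands for row (toℕ i + 1);
-- column j : Fin c stands for column r + toℕ j + 1.  B i j ≡ true iff the cell is in B.
Board : ℕ → ℕ → Set
Board r c = Fin r → Fin c → Bool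

RowsColsNonempty : ∀ {r c} → Board r c → Set
RowsColsNonempty {r} {c} B =
  ((i : Fin r) → ∃[ j ] B i j ≡ true) × ((j : Fin c) → ∃[ i ] B i j ≡ true)

Placement : ℕ → ℕ → Set
Placement r c = Fin r → Fin c → Bool

NonAttackingOn : ∀ {r c} → Board r c → Placement r c → Set
NonAttackingOn {r} {c} B σ =
  ((i : Fin r) (j : Fin c) → σ i j ≡ true → B i j ≡ true) ×
  ((i : Fin r) (j j′ : Fin c) → σ i j ≡ true → σ i j′ ≡ true → j ≡ j′) ×
  ((i i′ : Fin r) (j : Fin c) → σ i j ≡ true → σ i′ j ≡ true → i ≡ i′)

NonNestingOn : ∀ {r c} → Board r c → Placement r c → Set
NonNestingOn {r} {c} B σ =
  NonAttackingOn B σ ×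
  ((i k : Fin r) (j l : Fin c) → σ i j ≡ true → σ k l ≡ true → i <ᶠ k → ¬ (j <ᶠ l))

anyFin : ∀ {n} → (Fin n → Bool) → Bool
anyFin {zero}  f = false
anyFin {suc n} f = f zero ∨ anyFin (λ i → f (suc i))

-- R(σ) ∪ C(σ) ⊆ [r+c]: element x < r is row x+1 (in iff occupied);
-- element r + j is column r+j+1 (in iff not occupied).
RC : ∀ {r c} → Placement r c → Subset (r + c)
RC {r} {c} σ = tabulate f
  where
  f : Fin (r + c) → Bool
  f x with splitAt r x
  ... | inj₁ i = anyFin (λ j → σ i j)
  ... | inj₂ j = not (anyFin (λ i → σ i j))

RookBases : ∀ {r c} → Board r c → Subset (r + c) → Set
RookBases {r} {c} B S = ∃[ σ ] (NonNestingOn B σ × RC σ ≡ S)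

IsMatroidBases : ∀ {n} → (Subset n → Set) → Set
IsMatroidBases {n} 𝓑 =
  (∃[ S ] 𝓑 S) ×
  ((B₁ B₂ : Subset n) → 𝓑 B₁ → 𝓑 B₂ → (x : Fin n) → x ∈ B₁ → x ∉ B₂ →
     ∃[ y ] (y ∈ B₂ × y ∉ B₁ × 𝓑 ((B₁ - x) ∪ ⁅ y ⁆)))

-- B equals the skew shape λ/μ: λ, μ partitions with at most r parts (weakly
-- decreasing, μ ⊆ λ), parts of λ at most c (so λ/μ ⊆ [r]×[r+1,r+c]), and
-- cell (i, r+j) ∈ B  iff  μ_i < j ≤ λ_i  (1-based j = toℕ j + 1).
IsSkewShape : ∀ {r c} → Board r c → Set
IsSkewShape {r} {c} B =
  Σ (Fin r → ℕ) λ lam → Σ (Fin r → ℕ) λ mu →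
    ((i k : Fin r) → i ≤ᶠ k → lam k ≤ lam i) ×
    ((i k : Fin r) → i ≤ᶠ k → mu k ≤ mu i) ×
    ((i : Fin r) → mu i ≤ lam i) ×
    ((i : Fin r) → lam i ≤ c) ×
    ((i : Fin r) (j : Fin c) →
       (B i j ≡ true → (mu i Data.Nat.< suc (toℕ j)) × (suc (toℕ j) ≤ lam i)) ×
       ((mu i Data.Nat.< suc (toℕ j)) × (suc (toℕ j) ≤ lam i) → B i j ≡ true))

{-# OPTIONS --safe #-}
module Submission where

-- A single rook on a cell of B is a non-nesting placement, so its set R ∪ C is a basis.
-- Exchanging the free column l of the rook on (i,j) into the basis of the rook on (k,l)
-- gives a non-nesting placement that either has a rook on (i,l) or contains both (i,j)
-- and (k,l); when i < k and j < l the latter nests, so (i,l) ∈ B, and symmetrically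
-- (k,j) ∈ B.  With no empty row or column, this closure property makes every row an
-- interval (a gap at (i,j) is filled from a cell of column j above or below row i)
-- whose endpoints weakly decrease downwards, i.e. B is a skew shape.

open import Defs
open import Data.Nat using (ℕ; zero; suc; _+_; _≤_; s≤s; s≤s⁻¹; z≤n)
import Data.Nat.Properties as ℕ
open import Data.Nat.Properties using (m≤n⇒m≤1+n; ≤-refl)
open import Data.Bool using (Bool; true; false; not; _∧_)
open import Data.Bool.Properties using (¬-not) renaming (_≟_ to _≟ᵇ_)
open import Data.Fin using (Fin; zero; suc; splitAt; toℕ; _↑ˡ_; _↑ʳ_; _≟_)
  renaming (_<_ to _<ᶠ_; _≤_ to _≤ᶠ_)
open import Data.Fin.Properties
  using (splitAt-↑ˡ; splitAt-↑ʳ; ↑ʳ-injective; toℕ<n; <-cmp; <⇒≢; ≤∧≢⇒<; any?)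
open import Data.Fin.Subset using (Subset; _∈_; _∉_; _-_; _∪_; ⁅_⁆)
open import Data.Fin.Subset.Properties
  using (x∈p∪q⁺; x∈p∪q⁻; x∈p∧x≢y⇒x∈p-y; p─q⊆p; x∈⁅y⁆⇒x≡y; x≢y⇒x∉⁅y⁆)
open import Data.Vec using (_∷_; lookup; there)
open import Data.Vec.Properties using (lookup∘tabulate; lookup⇒[]=; []=⇒lookup)
open import Data.Sum using (_⊎_; inj₁; inj₂; [_,_]′)
open import Data.Product using (_×_; _,_; proj₁; proj₂; ∃; ∃-syntax)
open import Function using (_∘_; _∋_; id)
open import Data.Empty using (⊥-elim)
open import Relation.Binary using (tri<; tri≈; tri>)
open import Relation.Binary.PropositionalEquality
open import Relation.Nullary using (¬_; Dec; yes; no; contradiction)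
open import Relation.Nullary.Decidable using (⌊_⌋)
open import Relation.Unary using (Pred; Decidable)

anyFin⁺ : ∀ {n} (f : Fin n → Bool) {j} → f j ≡ true → anyFin f ≡ true
anyFin⁺ f {zero} fj rewrite fj = refl
anyFin⁺ f {suc j} fj with f zero
... | true  = refl
... | false = anyFin⁺ (f ∘ suc) fj

anyFin⁻ : ∀ {n} (f : Fin n → Bool) → anyFin f ≡ true → ∃[ j ] f j ≡ true
anyFin⁻ {suc n} f any with f zero in f0≡true
... | true  = zero , f0≡true
... | false = let j , fj = anyFin⁻ (f ∘ suc) any in suc j , fj

∃-least : ∀ {n p} {P : Pred (Fin n) p} → Decidable P → ∃ P → ∃[ i ] (P i × ∀ {j} → P j → i ≤ᶠ j)
∃-least {suc n} {P = P} P? (i , Pi) with P? zero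
... | yes P0 = zero , P0 , λ _ → z≤n
... | no ¬P0 with i
...   | zero   = contradiction Pi ¬P0
...   | suc i′ = let m , Pm , m≤ = ∃-least (P? ∘ suc) (i′ , Pi) in suc m , Pm , suc-bound m≤
  where
  suc-bound : ∀ {m} → (∀ {j} → P (suc j) → m ≤ᶠ j) → ∀ {j} → P j → suc m ≤ᶠ j
  suc-bound m≤ {zero}  P0 = contradiction P0 ¬P0
  suc-bound m≤ {suc j} Pj = s≤s (m≤ Pj)

∃-greatest : ∀ {n p} {P : Pred (Fin n) p} → Decidable P → ∃ P → ∃[ i ] (P i × ∀ {j} → P j → j ≤ᶠ i)
∃-greatest {suc n} {P = P} P? (i , Pi) with any? (P? ∘ suc)
... | yes witness = let m , Pm , ≤m = ∃-greatest (P? ∘ suc) witness in suc m , Pm , suc-bound ≤m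
  where
  suc-bound : ∀ {m} → (∀ {j} → P (suc j) → j ≤ᶠ m) → ∀ {j} → P j → j ≤ᶠ suc m
  suc-bound ≤m {zero}  _  = z≤n
  suc-bound ≤m {suc j} Pj = s≤s (≤m Pj)
... | no none = zero , only-zero i Pi , bound
  where
  only-zero : ∀ i → P i → P zero
  only-zero zero    Pi = Pi
  only-zero (suc i) Pi = contradiction (i , Pi) none
  bound : ∀ {j} → P j → toℕ j ≤ 0
  bound {zero}  _  = z≤n
  bound {suc j} Pj = contradiction (j , Pj) none

x∉p-x : ∀ {n} (p : Subset n) (x : Fin n) → x ∉ p - x
x∉p-x (_ ∷ p) zero    ()
x∉p-x (_ ∷ p) (suc x) (there x∈p-x) = x∉p-x p x x∈p-x

module _ {n} {p : Subset n} {x y : Fin n} where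

  ∈-exchange⁺ : ∀ {z} → z ∈ p → z ≢ x → z ∈ (p - x) ∪ ⁅ y ⁆
  ∈-exchange⁺ z∈p z≢x = x∈p∪q⁺ (inj₁ (x∈p∧x≢y⇒x∈p-y z∈p z≢x))

  ∈-exchange⁻ : ∀ {z} → z ∈ (p - x) ∪ ⁅ y ⁆ → z ∈ p ⊎ z ≡ y
  ∈-exchange⁻ z∈ with x∈p∪q⁻ (p - x) ⁅ y ⁆ z∈
  ... | inj₁ z∈p-x = inj₁ (p─q⊆p p ⁅ x ⁆ z∈p-x)
  ... | inj₂ z∈⁅y⁆ = inj₂ (x∈⁅y⁆⇒x≡y y z∈⁅y⁆)

  ∉-exchange : x ≢ y → x ∉ (p - x) ∪ ⁅ y ⁆
  ∉-exchange x≢y x∈ with x∈p∪q⁻ (p - x) ⁅ y ⁆ x∈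
  ... | inj₁ x∈p-x = x∉p-x p x x∈p-x
  ... | inj₂ x∈⁅y⁆ = x≢y⇒x∉⁅y⁆ x≢y x∈⁅y⁆

row≢col : ∀ {r c} {i : Fin r} {j : Fin c} → i ↑ˡ c ≢ r ↑ʳ j
row≢col {r} {c} {i} {j} eq
  with trans (sym (splitAt-↑ˡ r i c)) (trans (cong (splitAt r) eq) (splitAt-↑ʳ r c j))
... | ()

module _ {r c} (σ : Placement r c) where

  -- The ∋ fixes the (unnameable, where-bound) function that RC tabulates.
  lookup-RC-row : ∀ i → lookup (RC σ) (i ↑ˡ c) ≡ anyFin (σ i)
  lookup-RC-row i with splitAt r (i ↑ˡ c) | splitAt-↑ˡ r i c
                     | (lookup (RC σ) (i ↑ˡ c) ≡ _ ∋ lookup∘tabulate _ (i ↑ˡ c))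
  ... | _ | refl | eq = eq

  lookup-RC-col : ∀ j → lookup (RC σ) (r ↑ʳ j) ≡ not (anyFin (λ i → σ i j))
  lookup-RC-col j with splitAt r (r ↑ʳ j) | splitAt-↑ʳ r c j
                     | (lookup (RC σ) (r ↑ʳ j) ≡ _ ∋ lookup∘tabulate _ (r ↑ʳ j))
  ... | _ | refl | eq = eq

  row∈RC⁺ : ∀ {i j} → σ i j ≡ true → i ↑ˡ c ∈ RC σ
  row∈RC⁺ {i} σij = lookup⇒[]= _ (RC σ) (trans (lookup-RC-row i) (anyFin⁺ (σ i) σij))

  row∈RC⁻ : ∀ {i} → i ↑ˡ c ∈ RC σ → ∃[ j ] σ i j ≡ true
  row∈RC⁻ {i} i∈ = anyFin⁻ (σ i) (trans (sym (lookup-RC-row i)) ([]=⇒lookup i∈))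

  col∈RC⁺ : ∀ {j} → (∀ i → σ i j ≢ true) → r ↑ʳ j ∈ RC σ
  col∈RC⁺ {j} free = lookup⇒[]= _ (RC σ) (trans (lookup-RC-col j) (cong not (¬-not unoccupied)))
    where
    unoccupied : anyFin (λ i → σ i j) ≢ true
    unoccupied any = let i , σij = anyFin⁻ _ any in free i σij

  col∈RC⁻ : ∀ {i j} → r ↑ʳ j ∈ RC σ → σ i j ≢ true
  col∈RC⁻ {i} {j} j∈ σij
    with trans (sym ([]=⇒lookup j∈))
               (trans (lookup-RC-col j) (cong not (anyFin⁺ (λ i → σ i j) σij)))
  ... | ()

  col∉RC⁻ : ∀ {j} → r ↑ʳ j ∉ RC σ → ∃[ i ] σ i j ≡ true
  col∉RC⁻ {j} j∉ = anyFin⁻ _ (¬-not λ any≡false →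
    j∉ (lookup⇒[]= _ (RC σ) (trans (lookup-RC-col j) (cong not any≡false))))

rook : ∀ {r c} → Fin r → Fin c → Placement r c
rook a b i j = ⌊ i ≟ a ⌋ ∧ ⌊ j ≟ b ⌋

module _ {r c} {a : Fin r} {b : Fin c} where

  rook⁻ : ∀ i j → rook a b i j ≡ true → i ≡ a × j ≡ b
  rook⁻ i j _ with i ≟ a | j ≟ b
  rook⁻ _ _ _  | yes i≡a | yes j≡b = i≡a , j≡b
  rook⁻ _ _ () | yes _   | no _
  rook⁻ _ _ () | no _    | _

  rook⁺ : rook a b a b ≡ true
  rook⁺ with a ≟ a | b ≟ b
  ... | yes _ | yes _   = refl
  ... | yes _ | no b≢b  = contradiction refl b≢b
  ... | no a≢a | _      = contradiction refl a≢a

  rook-nonNesting : {B : Board r c} → B a b ≡ true → NonNestingOn B (rook a b)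
  rook-nonNesting {B} Bab = (⊆B , same-row , same-col) , non-nesting
    where
    ⊆B : ∀ i j → rook a b i j ≡ true → B i j ≡ true
    ⊆B i j ρij with rook⁻ i j ρij
    ... | refl , refl = Bab
    same-row : ∀ i j j′ → rook a b i j ≡ true → rook a b i j′ ≡ true → j ≡ j′
    same-row i j j′ ρij ρij′ = trans (proj₂ (rook⁻ i j ρij)) (sym (proj₂ (rook⁻ i j′ ρij′)))
    same-col : ∀ i i′ j → rook a b i j ≡ true → rook a b i′ j ≡ true → i ≡ i′
    same-col i i′ j ρij ρi′j = trans (proj₁ (rook⁻ i j ρij)) (sym (proj₁ (rook⁻ i′ j ρi′j)))
    non-nesting : ∀ i k j l → rook a b i j ≡ true → rook a b k l ≡ true → i <ᶠ k → ¬ (j <ᶠ l)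
    non-nesting i k j l ρij ρkl i<k _ =
      <⇒≢ i<k (trans (proj₁ (rook⁻ i j ρij)) (sym (proj₁ (rook⁻ k l ρkl))))

  row∈RC-rook⁻ : ∀ {i} → i ↑ˡ c ∈ RC (rook a b) → i ≡ a
  row∈RC-rook⁻ {i} i∈ = let j , ρij = row∈RC⁻ (rook a b) i∈ in proj₁ (rook⁻ i j ρij)

  row∈RC-rook : a ↑ˡ c ∈ RC (rook a b)
  row∈RC-rook = row∈RC⁺ (rook a b) rook⁺

  col∈RC-rook : ∀ {j} → j ≢ b → r ↑ʳ j ∈ RC (rook a b)
  col∈RC-rook j≢b = col∈RC⁺ (rook a b) λ i ρij → j≢b (proj₂ (rook⁻ i _ ρij))

  col∉RC-rook : r ↑ʳ b ∉ RC (rook a b)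
  col∉RC-rook b∈ = col∈RC⁻ (rook a b) b∈ rook⁺

module _ {r c} {B : Board r c} where

  -- Column b′ left the basis, so it is filled in σ, by a rook in row a or in row a′; then
  -- the rook of row a can only be in column b, as all other columns are free in σ.
  exchanged-rook-placement : ∀ {a a′ b b′} → a ≢ a′ →
    {σ : Placement r c} → NonAttackingOn B σ →
    {y : Fin (r + c)} → y ∈ RC (rook a′ b′) → RC σ ≡ (RC (rook a b) - (r ↑ʳ b′)) ∪ ⁅ y ⁆ →
    B a b′ ≡ true ⊎ (σ a b ≡ true × σ a′ b′ ≡ true)
  exchanged-rook-placement {a} {a′} {b} {b′} a≢a′ {σ} (σ⊆B , _ , col-unique) {y} y∈ RCσ≡ =
    from-occupant (col∉RC⁻ σ (∉-exchange col≢y ∘ RCσ⇒))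
    where
    RCσ⇒ : ∀ {z} → z ∈ RC σ → z ∈ (RC (rook a b) - (r ↑ʳ b′)) ∪ ⁅ y ⁆
    RCσ⇒ {z} = subst (z ∈_) RCσ≡
    ⇒RCσ : ∀ {z} → z ∈ (RC (rook a b) - (r ↑ʳ b′)) ∪ ⁅ y ⁆ → z ∈ RC σ
    ⇒RCσ {z} = subst (z ∈_) (sym RCσ≡)
    col≢y : r ↑ʳ b′ ≢ y
    col≢y refl = col∉RC-rook {a = a′} y∈
    rook-in-row-a : σ a′ b′ ≡ true → σ a b ≡ true
    rook-in-row-a σa′b′ with row∈RC⁻ σ (⇒RCσ (∈-exchange⁺ row∈RC-rook row≢col))
    ... | j , σaj with j ≟ b
    ...   | yes refl = σaj
    ...   | no j≢b = contradiction σaj (col∈RC⁻ σ (⇒RCσ (∈-exchange⁺ (col∈RC-rook j≢b) j≢b′)))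
      where
      j≢b′ : r ↑ʳ j ≢ r ↑ʳ b′
      j≢b′ j≡b′ = a≢a′ (col-unique a a′ b′ σab′ σa′b′)
        where
        σab′ : σ a b′ ≡ true
        σab′ = subst (λ j → σ a j ≡ true) (↑ʳ-injective r j b′ j≡b′) σaj
    from-occupant : ∃[ i ] σ i b′ ≡ true → B a b′ ≡ true ⊎ (σ a b ≡ true × σ a′ b′ ≡ true)
    from-occupant (i , σib′) with ∈-exchange⁻ (RCσ⇒ (row∈RC⁺ σ σib′))
    ... | inj₁ i∈ = inj₁ (subst (λ i → B i b′ ≡ true) (row∈RC-rook⁻ i∈) (σ⊆B i b′ σib′))
    ... | inj₂ i≡y = inj₂ (rook-in-row-a σa′b′ , σa′b′)
      where
      σa′b′ : σ a′ b′ ≡ true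
      σa′b′ = subst (λ i → σ i b′ ≡ true) i≡a′ σib′
        where
        i≡a′ : i ≡ a′
        i≡a′ = row∈RC-rook⁻ (subst (_∈ RC (rook a′ b′)) (sym i≡y) y∈)

  rook-exchange : IsMatroidBases (RookBases B) → ∀ {a a′ b b′} → a ≢ a′ → b ≢ b′ →
    B a b ≡ true → B a′ b′ ≡ true →
    B a b′ ≡ true ⊎ ∃[ σ ] (NonNestingOn B σ × σ a b ≡ true × σ a′ b′ ≡ true)
  rook-exchange (_ , exchange) {a} {a′} {b} {b′} a≢a′ b≢b′ Bab Ba′b′
    with exchange (RC (rook a b)) (RC (rook a′ b′))
                  (rook a b , rook-nonNesting Bab , refl)
                  (rook a′ b′ , rook-nonNesting Ba′b′ , refl)
                  (r ↑ʳ b′) (col∈RC-rook (b≢b′ ∘ sym)) (col∉RC-rook {a = a′})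
  ... | y , y∈ , _ , σ , (σ-nonAttacking , σ-nonNesting) , RCσ≡
    with exchanged-rook-placement a≢a′ σ-nonAttacking y∈ RCσ≡
  ...   | inj₁ Bab′         = inj₁ Bab′
  ...   | inj₂ (σab , σa′b′) = inj₂ (σ , (σ-nonAttacking , σ-nonNesting) , σab , σa′b′)

RectangleClosed : ∀ {r c} → Board r c → Set
RectangleClosed {r} {c} B = ∀ {i k : Fin r} {j l : Fin c} → i <ᶠ k → j <ᶠ l →
  B i j ≡ true → B k l ≡ true → B i l ≡ true × B k j ≡ true

matroid⇒rectangleClosed : ∀ {r c} {B : Board r c} → IsMatroidBases (RookBases B) → RectangleClosed B
matroid⇒rectangleClosed {B = B} isMatroid {i} {k} {j} {l} i<k j<l Bij Bkl =
  [ id , ⊥-elim ∘ nesting ]′ (rook-exchange isMatroid (<⇒≢ i<k) (<⇒≢ j<l) Bij Bkl) ,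
  [ id , ⊥-elim ∘ nesting′ ]′ (rook-exchange isMatroid (<⇒≢ i<k ∘ sym) (<⇒≢ j<l ∘ sym) Bkl Bij)
  where
  nesting : ¬ (∃[ σ ] (NonNestingOn B σ × σ i j ≡ true × σ k l ≡ true))
  nesting (_ , (_ , non-nesting) , σij , σkl) = non-nesting i k j l σij σkl i<k j<l
  nesting′ : ¬ (∃[ σ ] (NonNestingOn B σ × σ k l ≡ true × σ i j ≡ true))
  nesting′ (σ , nonNesting , σkl , σij) = nesting (σ , nonNesting , σij , σkl)

<-antitone⇒≤-antitone : ∀ {n} (f : Fin n → ℕ) → (∀ {i k} → i <ᶠ k → f k ≤ f i) →
  ∀ i k → i ≤ᶠ k → f k ≤ f i
<-antitone⇒≤-antitone f antitone i k i≤k with i ≟ k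
... | yes refl = ≤-refl
... | no i≢k   = antitone (≤∧≢⇒< i≤k i≢k)

module _ {r c} {B : Board r c} (nonempty : RowsColsNonempty B) (closed : RectangleClosed B) where

  private
    B? : ∀ i j → Dec (B i j ≡ true)
    B? i j = B i j ≟ᵇ true

    first-cell : ∀ i → ∃[ j ] (B i j ≡ true × ∀ {j′} → B i j′ ≡ true → j ≤ᶠ j′)
    first-cell i = ∃-least (B? i) (proj₁ nonempty i)

    last-cell : ∀ i → ∃[ j ] (B i j ≡ true × ∀ {j′} → B i j′ ≡ true → j′ ≤ᶠ j)
    last-cell i = ∃-greatest (B? i) (proj₁ nonempty i)

    first last : Fin r → Fin c
    first = proj₁ ∘ first-cell
    last  = proj₁ ∘ last-cell

    B-first : ∀ i → B i (first i) ≡ true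
    B-first = proj₁ ∘ proj₂ ∘ first-cell

    B-last : ∀ i → B i (last i) ≡ true
    B-last = proj₁ ∘ proj₂ ∘ last-cell

    first≤ : ∀ i {j} → B i j ≡ true → first i ≤ᶠ j
    first≤ i = proj₂ (proj₂ (first-cell i))

    ≤last : ∀ i {j} → B i j ≡ true → j ≤ᶠ last i
    ≤last i = proj₂ (proj₂ (last-cell i))

    first-antitone : ∀ {i k} → i <ᶠ k → first k ≤ᶠ first i
    first-antitone {i} {k} i<k with toℕ (first k) ℕ.≤? toℕ (first i)
    ... | yes ≤ = ≤
    ... | no ≰  = first≤ k (proj₂ (closed i<k (ℕ.≰⇒> ≰) (B-first i) (B-first k)))

    last-antitone : ∀ {i k} → i <ᶠ k → last k ≤ᶠ last i
    last-antitone {i} {k} i<k with toℕ (last k) ℕ.≤? toℕ (last i)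
    ... | yes ≤ = ≤
    ... | no ≰  = ≤last i (proj₁ (closed i<k (ℕ.≰⇒> ≰) (B-last i) (B-last k)))

    cell-between : ∀ {i j} → first i ≤ᶠ j → j ≤ᶠ last i → B i j ≡ true
    cell-between {i} {j} first≤j j≤last with proj₂ nonempty j
    ... | k , Bkj with <-cmp i k
    ...   | tri≈ _ refl _ = Bkj
    ...   | tri< i<k _ _ with first i ≟ j
    ...     | yes refl  = B-first i
    ...     | no first≢j = proj₁ (closed i<k (≤∧≢⇒< first≤j first≢j) (B-first i) Bkj)
    cell-between {i} {j} first≤j j≤last | k , Bkj | tri> _ _ k<i with j ≟ last i
    ...     | yes refl  = B-last i
    ...     | no j≢last = proj₂ (closed k<i (≤∧≢⇒< j≤last j≢last) Bkj (B-last i))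

  rectangleClosed⇒skewShape : IsSkewShape B
  rectangleClosed⇒skewShape =
    lam , mu ,
    <-antitone⇒≤-antitone lam (s≤s ∘ last-antitone) ,
    <-antitone⇒≤-antitone mu first-antitone ,
    (λ i → m≤n⇒m≤1+n (first≤ i (B-last i))) ,
    (λ i → toℕ<n (last i)) ,
    λ i j → (λ Bij → s≤s (first≤ i Bij) , s≤s (≤last i Bij)) ,
            λ (mu<1+j , 1+j≤lam) → cell-between (s≤s⁻¹ mu<1+j) (s≤s⁻¹ 1+j≤lam)
    where
    lam mu : Fin r → ℕ
    lam i = suc (toℕ (last i))
    mu i  = toℕ (first i)

proposition3p5 : (r c : ℕ) → 1 ≤ r → 1 ≤ c → (B : Board r c) → RowsColsNonempty B →
    IsMatroidBases (RookBases B) → IsSkewShape B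
proposition3p5 _ _ _ _ _ nonempty isMatroid =
  rectangleClosed⇒skewShape nonempty (matroid⇒rectangleClosed isMatroid)
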